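{- Let $q=2^m$ with $m>1$ odd, $\tau=2^{(m+1)/2}$, and let $c\in\mathbb F_q^*$ satisfy $\mathrm{Tr}_{q/2}(c^{\tau+2}+c+1)=0$. Put $v=\frac{1}{c^{\tau}+1}\left(c^2+c^{1-\tau}+c^{\tau+1}\right)$ and $$f_1(X)=\frac{X^{\tau}}{c^{\tau}}+\frac{X}{c^2}+\left(\frac1c+1\right)^{\tau+2}+\frac{v}{c^2}+\frac{v^{\tau}}{c^{\tau}}+\frac{1}{c^{\tau+1}}.$$ Then the equation $f_1(X)=0$ has two nonzero solutions in $\mathbb F_q$.
   Context: $\mathrm{Tr}_{q/2}(x)=x+x^2+\cdots+x^{2^{m-1}}$ is the absolute trace from $\mathbb F_q$ to $\mathbb F_2$. (Note $c\neq1$ under the hypothesis, so $v$ is well defined.) -}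

module Defs where

open import Level using (0ℓ)
open import Data.Nat using (ℕ; zero; suc) renaming (_^_ to _^ℕ_)
open import Data.Fin using (Fin)
open import Relation.Binary.PropositionalEquality using (_≡_; _≢_)
open import Algebra.Structures using (IsCommutativeRing)
open import Function.Bundles using (_↔_)

-- A finite field of order 2 ^ m, with propositional equality on the carrier.
-- inv is a total function which is a multiplicative inverse on nonzero elements
-- (its value at 0 is irrelevant; it is only ever applied to nonzero elements).
record FiniteField (m : ℕ) : Set₁ where
  infixl 6 _+_
  infixl 7 _*_
  field
    F       : Set
    _+_     : F → F → F
    _*_     : F → F → F
    -_      : F → F
    0#      : F
    1#      : F
    inv     : F → F
    isCommutativeRing : IsCommutativeRing _≡_ _+_ _*_ -_ 0# 1#
    0≢1     : 0# ≢ 1#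
    inv-r   : ∀ x → x ≢ 0# → x * inv x ≡ 1#
    card    : F ↔ Fin (2 ^ℕ m)

  _^_ : F → ℕ → F
  x ^ zero  = 1#
  x ^ suc n = x * (x ^ n)

  infixr 8 _^_

  _/_ : F → F → F
  x / y = x * inv y

  infixl 7 _/_

  trace-sum : ℕ → F → F
  trace-sum zero    x = 0#
  trace-sum (suc i) x = trace-sum i x + x ^ (2 ^ℕ i)

  Tr : F → F
  Tr x = trace-sum m x

module Submission where

-- Let u = c ^ τ and σ x = x ^ τ; since τ² = 2 · 2^m, σ is a field automorphism with σ (σ x) = x².
-- Clearing the inverses of c and u, f₁ X = u⁻¹ c⁻² (c² σX + u X + B) for an explicit constant B,
-- so f₁ (u⁻¹ Z) = 0 whenever σZ + Z = B. With y the half-trace solution of y² + y = u c² + c + 1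
-- (which needs Tr (u c² + c + 1) = 0), both Z = σy + y + u v + u and Z + 1 qualify.
-- These roots are nonzero because B ≠ 0: clearing denominators, B = 0 gives N (c, u) = 0, applying
-- σ gives N (u, c²) = 0, and eliminating u gives c⁴ (c+1)² (c⁴+c+1) (c⁴+c³+1) (c⁶+c³+1) (c⁶+c⁴+c²+c+1) = 0.
-- But the roots of the last four factors have order dividing 4095 = 2¹² - 1, so they would lie in
-- 𝔽_{2^12} ∩ 𝔽_{2^m} ⊆ 𝔽₈ (m is odd), where those polynomials have no roots; likewise c ≠ 1, for
-- otherwise y² + y + 1 = 0.

open import Level using (0ℓ)
open import Data.Bool using (Bool; true; false; _xor_; _∧_)
open import Data.Bool.Properties using (xor-∧-commutativeRing)
open import Data.Empty using (⊥-elim)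
open import Data.Fin using (Fin; zero; suc)
import Data.Fin.Properties as Fin
open import Data.Maybe using (Maybe; just; nothing)
open import Data.Nat using (ℕ; zero; suc; _≤_)
  renaming (_+_ to _+ℕ_; _*_ to _*ℕ_; _^_ to _^ℕ_; _<_ to _<ℕ_)
import Data.Nat.Properties as ℕ
open import Data.Nat.Tactic.RingSolver using (solve-∀)
open import Data.Product using (Σ; _×_; _,_)
open import Data.Vec using ([]; _∷_)
import Data.Vec as Vec
open import Data.Vec.Properties using (lookup-map)
open import Function using (_∘_; Inverse; _↔_; mk↔ₛ′)
open import Function.Construct.Composition using (_↔-∘_)
open import Function.Construct.Symmetry using (↔-sym)
open import Function.Properties.Inverse using (Inverse⇒Injection)
open import Relation.Binary.Definitions using (DecidableEquality)
open import Relation.Binary.PropositionalEquality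
open import Relation.Nullary using (yes; no)
open import Relation.Nullary.Decidable using (via-injection)
open import Algebra.Bundles using (CommutativeRing)
open import Algebra.Structures using (IsCommutativeRing)
open import Algebra.Solver.Ring.AlmostCommutativeRing
  using (AlmostCommutativeRing; _-Raw-AlmostCommutative⟶_)

open import Defs

module Char2RingSolver
  {F : Set} {_+_ _*_ : F → F → F} { -_ : F → F } {0# 1# : F}
  (isCommutativeRing : IsCommutativeRing _≡_ _+_ _*_ -_ 0# 1#)
  (1+1≡0 : 1# + 1# ≡ 0#)
  where

  open IsCommutativeRing isCommutativeRing
    using (isCommutativeSemiring; +-identityˡ; +-identityʳ; *-identityˡ; zeroˡ; zeroʳ)

  -- In characteristic 2 negation is the identity, and the coefficients live in 𝔽₂ = Bool.
  char2Ring : AlmostCommutativeRing 0ℓ 0ℓ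
  char2Ring = record
    { Carrier = F ; _≈_ = _≡_ ; _+_ = _+_ ; _*_ = _*_ ; -_ = λ x → x ; 0# = 0# ; 1# = 1#
    ; isAlmostCommutativeRing = record
      { isCommutativeSemiring = isCommutativeSemiring
      ; -‿cong = λ x≡y → x≡y
      ; -‿*-distribˡ = λ _ _ → refl
      ; -‿+-comm = λ _ _ → refl
      }
    }

  ⟦_⟧₂ : Bool → F
  ⟦ true  ⟧₂ = 1#
  ⟦ false ⟧₂ = 0#

  𝔽₂⟶F : CommutativeRing.rawRing xor-∧-commutativeRing -Raw-AlmostCommutative⟶ char2Ring
  𝔽₂⟶F = record
    { ⟦_⟧ = ⟦_⟧₂ ; +-homo = +-homo ; *-homo = *-homo ; -‿homo = λ _ → refl ; 0-homo = refl ; 1-homo = refl }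
    where
    +-homo : ∀ a b → ⟦ a xor b ⟧₂ ≡ ⟦ a ⟧₂ + ⟦ b ⟧₂
    +-homo true  true  = sym 1+1≡0
    +-homo true  false = sym (+-identityʳ 1#)
    +-homo false b     = sym (+-identityˡ ⟦ b ⟧₂)
    *-homo : ∀ a b → ⟦ a ∧ b ⟧₂ ≡ ⟦ a ⟧₂ * ⟦ b ⟧₂
    *-homo true  b = sym (*-identityˡ ⟦ b ⟧₂)
    *-homo false b = sym (zeroˡ ⟦ b ⟧₂)

  ≟₂ : ∀ a b → Maybe (⟦ a ⟧₂ ≡ ⟦ b ⟧₂)
  ≟₂ true  true  = just refl
  ≟₂ false false = just refl
  ≟₂ _     _     = nothing

  open import Algebra.Solver.Ring (CommutativeRing.rawRing xor-∧-commutativeRing) char2Ring 𝔽₂⟶F ≟₂ public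

  :0 :1 : ∀ {n} → Polynomial n
  :0 = con false
  :1 = con true

  x₀ : ∀ {n} → Polynomial (1 +ℕ n)
  x₀ = var zero
  x₁ : ∀ {n} → Polynomial (2 +ℕ n)
  x₁ = var (suc zero)
  x₂ : ∀ {n} → Polynomial (3 +ℕ n)
  x₂ = var (suc (suc zero))
  x₃ : ∀ {n} → Polynomial (4 +ℕ n)
  x₃ = var (suc (suc (suc zero)))

  ≡⇒+≡0 : ∀ {x y} → x ≡ y → x + y ≡ 0#
  ≡⇒+≡0 {x} refl = solve 1 (λ x → x :+ x := :0) refl x

  +≡0⇒≡ : ∀ {x y} → x + y ≡ 0# → x ≡ y
  +≡0⇒≡ {x} {y} x+y≡0 = begin
    x             ≡⟨ solve 2 (λ x y → x := (x :+ y) :+ y) refl x y ⟩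
    (x + y) + y   ≡⟨ cong (_+ y) x+y≡0 ⟩
    0# + y        ≡⟨ +-identityˡ y ⟩
    y             ∎
    where open ≡-Reasoning

  vanishes : ∀ q {p} → p ≡ 0# → q * p ≡ 0#
  vanishes q refl = zeroʳ q

  infixl 6 _⊕₀_
  _⊕₀_ : ∀ {p q} → p ≡ 0# → q ≡ 0# → p + q ≡ 0#
  refl ⊕₀ refl = +-identityˡ 0#

  -- Ideal-membership certificates: z is a combination Σ qᵢ pᵢ of terms known to vanish.
  certified : ∀ {lhs rhs z} → lhs ≡ rhs + z → z ≡ 0# → lhs ≡ rhs
  certified {rhs = rhs} lhs≡rhs+z refl = trans lhs≡rhs+z (+-identityʳ rhs)

  module _ (φ : F → F)
    (φ-+ : ∀ x y → φ (x + y) ≡ φ x + φ y) (φ-* : ∀ x y → φ (x * y) ≡ φ x * φ y)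
    (φ-0 : φ 0# ≡ 0#) (φ-1 : φ 1# ≡ 1#)
    where

    homomorphism-⟦⟧ : ∀ {n} (p : Polynomial n) (ρ : Env n) → φ (⟦ p ⟧ ρ) ≡ ⟦ p ⟧ (Vec.map φ ρ)
    homomorphism-⟦⟧ (op [+] p q) ρ = trans (φ-+ _ _) (cong₂ _+_ (homomorphism-⟦⟧ p ρ) (homomorphism-⟦⟧ q ρ))
    homomorphism-⟦⟧ (op [*] p q) ρ = trans (φ-* _ _) (cong₂ _*_ (homomorphism-⟦⟧ p ρ) (homomorphism-⟦⟧ q ρ))
    homomorphism-⟦⟧ (con true)   ρ = φ-1
    homomorphism-⟦⟧ (con false)  ρ = φ-0
    homomorphism-⟦⟧ (var i)      ρ = sym (lookup-map i φ ρ)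
    homomorphism-⟦⟧ (:- p)       ρ = homomorphism-⟦⟧ p ρ
    homomorphism-⟦⟧ (p :^ n)     ρ = homomorphism-^ n
      where
      homomorphism-^ : ∀ n → φ (⟦ p :^ n ⟧ ρ) ≡ ⟦ p :^ n ⟧ (Vec.map φ ρ)
      homomorphism-^ zero    = φ-1
      homomorphism-^ (suc n) = trans (φ-* _ _) (cong₂ _*_ (homomorphism-⟦⟧ p ρ) (homomorphism-^ n))

    homomorphism-≡ : ∀ {n} (p q : Polynomial n) (ρ : Env n) →
                     ⟦ p ⟧ ρ ≡ ⟦ q ⟧ ρ → ⟦ p ⟧ (Vec.map φ ρ) ≡ ⟦ q ⟧ (Vec.map φ ρ)
    homomorphism-≡ p q ρ p≡q =
      trans (sym (homomorphism-⟦⟧ p ρ)) (trans (cong φ p≡q) (homomorphism-⟦⟧ q ρ))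

module FiniteFieldProperties {m : ℕ} (K : FiniteField m) where

  open FiniteField K
  open IsCommutativeRing isCommutativeRing public
    using (+-identityˡ; +-identityʳ; *-assoc; *-comm; *-identityˡ; *-identityʳ; zeroˡ; zeroʳ; -‿inverseʳ)
  open ≡-Reasoning

  commutativeRing : CommutativeRing 0ℓ 0ℓ
  commutativeRing = record { isCommutativeRing = isCommutativeRing }

  open import Algebra.Properties.CommutativeSemigroup (CommutativeRing.*-commutativeSemigroup commutativeRing)
    using (x∙yz≈y∙xz) renaming (interchange to *-interchange)

  infix 4 _≟_
  _≟_ : DecidableEquality F
  _≟_ = via-injection (Inverse⇒Injection card) Fin._≟_

  0^n≡0 : ∀ {n} → 0 <ℕ n → 0# ^ n ≡ 0#
  0^n≡0 {suc n} _ = zeroˡ _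

  1^n≡1 : ∀ n → 1# ^ n ≡ 1#
  1^n≡1 zero    = refl
  1^n≡1 (suc n) = trans (*-identityˡ _) (1^n≡1 n)

  ^-distribˡ-+-* : ∀ x a b → x ^ (a +ℕ b) ≡ x ^ a * x ^ b
  ^-distribˡ-+-* x zero    b = sym (*-identityˡ _)
  ^-distribˡ-+-* x (suc a) b = trans (cong (x *_) (^-distribˡ-+-* x a b)) (sym (*-assoc _ _ _))

  ^-distribʳ-* : ∀ x y n → (x * y) ^ n ≡ x ^ n * y ^ n
  ^-distribʳ-* x y zero    = sym (*-identityˡ _)
  ^-distribʳ-* x y (suc n) = begin
    (x * y) * (x * y) ^ n      ≡⟨ cong ((x * y) *_) (^-distribʳ-* x y n) ⟩
    (x * y) * (x ^ n * y ^ n)  ≡⟨ *-interchange x y (x ^ n) (y ^ n) ⟩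
    (x * x ^ n) * (y * y ^ n)  ∎

  ^-*-assoc : ∀ x a b → (x ^ a) ^ b ≡ x ^ (a *ℕ b)
  ^-*-assoc x zero    b = 1^n≡1 b
  ^-*-assoc x (suc a) b = begin
    (x * x ^ a) ^ b        ≡⟨ ^-distribʳ-* x (x ^ a) b ⟩
    x ^ b * (x ^ a) ^ b    ≡⟨ cong (x ^ b *_) (^-*-assoc x a b) ⟩
    x ^ b * x ^ (a *ℕ b)   ≡⟨ ^-distribˡ-+-* x b (a *ℕ b) ⟨
    x ^ (b +ℕ a *ℕ b)      ∎

  1≢0 : 1# ≢ 0#
  1≢0 1≡0 = 0≢1 (sym 1≡0)

  inv-l : ∀ x → x ≢ 0# → inv x * x ≡ 1#
  inv-l x x≢0 = trans (*-comm _ _) (inv-r x x≢0)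

  *-cancelʳ : ∀ {x y} z → z ≢ 0# → x * z ≡ y * z → x ≡ y
  *-cancelʳ {x} {y} z z≢0 xz≡yz = begin
    x                ≡⟨ sym (*-identityʳ x) ⟩
    x * 1#           ≡⟨ cong (x *_) (inv-r z z≢0) ⟨
    x * (z * inv z)  ≡⟨ *-assoc x z (inv z) ⟨
    (x * z) * inv z  ≡⟨ cong (_* inv z) xz≡yz ⟩
    (y * z) * inv z  ≡⟨ *-assoc y z (inv z) ⟩
    y * (z * inv z)  ≡⟨ cong (y *_) (inv-r z z≢0) ⟩
    y * 1#           ≡⟨ *-identityʳ y ⟩
    y                ∎

  *-cancelˡ : ∀ {x y} z → z ≢ 0# → z * x ≡ z * y → x ≡ y
  *-cancelˡ {x} {y} z z≢0 zx≡zy = *-cancelʳ z z≢0 (trans (*-comm x z) (trans zx≡zy (*-comm z y)))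

  *-nonzero : ∀ {x y} → x ≢ 0# → y ≢ 0# → x * y ≢ 0#
  *-nonzero {x} {y} x≢0 y≢0 xy≡0 = y≢0 (*-cancelˡ x x≢0 (trans xy≡0 (sym (zeroʳ x))))

  ^-nonzero : ∀ {x} n → x ≢ 0# → x ^ n ≢ 0#
  ^-nonzero zero    x≢0 = 1≢0
  ^-nonzero (suc n) x≢0     = *-nonzero x≢0 (^-nonzero n x≢0)

  unit-nonzero : ∀ {x y} → x * y ≡ 1# → x ≢ 0#
  unit-nonzero {x} {y} xy≡1 refl = 0≢1 (trans (sym (zeroˡ y)) xy≡1)

  inv-unique : ∀ {x y} → x * y ≡ 1# → inv x ≡ y
  inv-unique {x} {y} xy≡1 =
    *-cancelˡ x (unit-nonzero xy≡1) (trans (inv-r x (unit-nonzero xy≡1)) (sym xy≡1))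

  inv-^ : ∀ {x} n → x ≢ 0# → inv (x ^ n) ≡ inv x ^ n
  inv-^ {x} n x≢0 = inv-unique (begin
    x ^ n * inv x ^ n  ≡⟨ ^-distribʳ-* x (inv x) n ⟨
    (x * inv x) ^ n    ≡⟨ cong (_^ n) (inv-r x x≢0) ⟩
    1# ^ n             ≡⟨ 1^n≡1 n ⟩
    1#                 ∎)

  module _ where
    open import Algebra.Properties.CommutativeMonoid.Sum (CommutativeRing.*-commutativeMonoid commutativeRing)
      using (sum-cong-≗; sum-permute) renaming (sum to ∏ᶠ)

    ∏ᶠ-scale : ∀ {n} a (f : Fin n → F) → ∏ᶠ (λ i → a * f i) ≡ a ^ n * ∏ᶠ f
    ∏ᶠ-scale {zero}  a f = sym (*-identityˡ 1#)
    ∏ᶠ-scale {suc n} a f = begin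
      (a * f zero) * ∏ᶠ (λ i → a * f (suc i))   ≡⟨ cong ((a * f zero) *_) (∏ᶠ-scale a (f ∘ suc)) ⟩
      (a * f zero) * (a ^ n * ∏ᶠ (f ∘ suc))     ≡⟨ *-interchange a (f zero) (a ^ n) (∏ᶠ (f ∘ suc)) ⟩
      (a * a ^ n) * (f zero * ∏ᶠ (f ∘ suc))     ∎

    ∏ᶠ-update : ∀ {n} a (f g : Fin n → F) j → f j ≡ a * g j → (∀ i → i ≢ j → f i ≡ g i) →
                ∏ᶠ f ≡ a * ∏ᶠ g
    ∏ᶠ-update a f g zero    fj≡agj others = begin
      f zero * ∏ᶠ (f ∘ suc)        ≡⟨ cong₂ _*_ fj≡agj (sum-cong-≗ (λ i → others (suc i) λ ())) ⟩
      (a * g zero) * ∏ᶠ (g ∘ suc)  ≡⟨ *-assoc a (g zero) (∏ᶠ (g ∘ suc)) ⟩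
      a * (g zero * ∏ᶠ (g ∘ suc))  ∎
    ∏ᶠ-update a f g (suc j) fj≡agj others = begin
      f zero * ∏ᶠ (f ∘ suc)        ≡⟨ cong₂ _*_ (others zero λ ())
                                        (∏ᶠ-update a (f ∘ suc) (g ∘ suc) j fj≡agj
                                          (λ i i≢j → others (suc i) (i≢j ∘ Fin.suc-injective))) ⟩
      g zero * (a * ∏ᶠ (g ∘ suc))  ≡⟨ x∙yz≈y∙xz (g zero) a (∏ᶠ (g ∘ suc)) ⟩
      a * (g zero * ∏ᶠ (g ∘ suc))  ∎

    ∏ᶠ-nonzero : ∀ {n} (f : Fin n → F) → (∀ i → f i ≢ 0#) → ∏ᶠ f ≢ 0#
    ∏ᶠ-nonzero {zero}  f _   = 1≢0
    ∏ᶠ-nonzero {suc n} f f≢0 = *-nonzero (f≢0 zero) (∏ᶠ-nonzero (f ∘ suc) (f≢0 ∘ suc))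

    open Inverse card using (to; from; strictlyInverseˡ; strictlyInverseʳ)

    ∏ : (F → F) → F
    ∏ f = ∏ᶠ (f ∘ from)

    ∏-permute : (π : F ↔ F) (f : F → F) → ∏ f ≡ ∏ (f ∘ Inverse.to π)
    ∏-permute π f = trans (sum-permute {2 ^ℕ m} {2 ^ℕ m} (f ∘ from) (card ↔-∘ (π ↔-∘ ↔-sym card)))
                          (sum-cong-≗ (λ i → cong f (strictlyInverseʳ (Inverse.to π (from i)))))

    ∏-cong : ∀ {f g : F → F} → (∀ x → f x ≡ g x) → ∏ f ≡ ∏ g
    ∏-cong f≗g = sum-cong-≗ (f≗g ∘ from)

    ∏-scale : ∀ a (f : F → F) → ∏ (λ x → a * f x) ≡ a ^ (2 ^ℕ m) * ∏ f
    ∏-scale a f = ∏ᶠ-scale a (f ∘ from)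

    ∏-nonzero : ∀ (f : F → F) → (∀ x → f x ≢ 0#) → ∏ f ≢ 0#
    ∏-nonzero f f≢0 = ∏ᶠ-nonzero (f ∘ from) (f≢0 ∘ from)

    ∏-update-0 : ∀ a (f g : F → F) → f 0# ≡ a * g 0# → (∀ x → x ≢ 0# → f x ≡ g x) → ∏ f ≡ a * ∏ g
    ∏-update-0 a f g f0≡ag0 others = ∏ᶠ-update a (f ∘ from) (g ∘ from) (to 0#)
      (subst (λ z → f z ≡ a * g z) (sym (strictlyInverseʳ 0#)) f0≡ag0)
      (λ i i≢to0 → others (from i) λ from-i≡0 → i≢to0 (trans (sym (strictlyInverseˡ i)) (cong to from-i≡0)))

  *-permutation : ∀ {a} → a ≢ 0# → F ↔ F
  *-permutation {a} a≢0 = mk↔ₛ′ (a *_) (inv a *_) (cancel a (inv a) (inv-r a a≢0)) (cancel (inv a) a (inv-l a a≢0))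
    where
    cancel : ∀ a b → a * b ≡ 1# → ∀ x → a * (b * x) ≡ x
    cancel a b ab≡1 x = trans (sym (*-assoc a b x)) (trans (cong (_* x) ab≡1) (*-identityˡ x))

  nonzeroOr : F → F → F
  nonzeroOr a x with x ≟ 0#
  ... | yes _ = a
  ... | no  _ = x

  nonzeroOr-nonzero : ∀ {a} x → a ≢ 0# → nonzeroOr a x ≢ 0#
  nonzeroOr-nonzero x a≢0 with x ≟ 0#
  ... | yes _   = a≢0
  ... | no  x≢0 = x≢0

  nonzeroOr-* : ∀ {a} x → a ≢ 0# → nonzeroOr a (a * x) ≡ a * nonzeroOr 1# x
  nonzeroOr-* {a} x a≢0 with x ≟ 0# | a * x ≟ 0#
  ... | yes _   | yes _    = sym (*-identityʳ a)
  ... | yes x≡0 | no ax≢0  = ⊥-elim (ax≢0 (trans (cong (a *_) x≡0) (zeroʳ a)))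
  ... | no  x≢0 | yes ax≡0 = ⊥-elim (*-nonzero a≢0 x≢0 ax≡0)
  ... | no  _   | no  _    = refl

  nonzeroOr-≢0 : ∀ a {x} → x ≢ 0# → nonzeroOr a x ≡ nonzeroOr 1# x
  nonzeroOr-≢0 a {x} x≢0 with x ≟ 0#
  ... | yes x≡0 = ⊥-elim (x≢0 x≡0)
  ... | no  _   = refl

  nonzeroOr-0 : ∀ a → nonzeroOr a 0# ≡ a * nonzeroOr 1# 0#
  nonzeroOr-0 a with 0# ≟ 0#
  ... | yes _   = sym (*-identityʳ a)
  ... | no  0≢0 = ⊥-elim (0≢0 refl)

  -- x ∈ 𝔽_{2^d}
  Fixed : ℕ → F → Set
  Fixed d x = x ^ (2 ^ℕ d) ≡ x

  -- With P the product of the nonzero elements, reindexing along y ↦ x y gives x ^ 2^m * P = x * P.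
  fermat : ∀ x → Fixed m x
  fermat x with x ≟ 0#
  ... | yes refl = 0^n≡0 (ℕ.m^n>0 2 m)
  ... | no x≢0 = *-cancelʳ P (∏-nonzero (nonzeroOr 1#) (λ y → nonzeroOr-nonzero y 1≢0)) (begin
    x ^ (2 ^ℕ m) * P               ≡⟨ ∏-scale x (nonzeroOr 1#) ⟨
    ∏ (λ y → x * nonzeroOr 1# y)   ≡⟨ ∏-cong (λ y → nonzeroOr-* y x≢0) ⟨
    ∏ (nonzeroOr x ∘ (x *_))       ≡⟨ ∏-permute (*-permutation x≢0) (nonzeroOr x) ⟨
    ∏ (nonzeroOr x)                ≡⟨ ∏-update-0 x (nonzeroOr x) (nonzeroOr 1#) (nonzeroOr-0 x)
                                        (λ y → nonzeroOr-≢0 x) ⟩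
    x * P                          ∎)
    where
    P : F
    P = ∏ (nonzeroOr 1#)

  fixed-shift : ∀ {a x} → Fixed a x → ∀ b → x ^ (2 ^ℕ (a +ℕ b)) ≡ x ^ (2 ^ℕ b)
  fixed-shift {a} {x} x∈𝔽 b = begin
    x ^ (2 ^ℕ (a +ℕ b))         ≡⟨ cong (x ^_) (ℕ.^-distribˡ-+-* 2 a b) ⟩
    x ^ (2 ^ℕ a *ℕ 2 ^ℕ b)      ≡⟨ ^-*-assoc x (2 ^ℕ a) (2 ^ℕ b) ⟨
    (x ^ (2 ^ℕ a)) ^ (2 ^ℕ b)   ≡⟨ cong (_^ (2 ^ℕ b)) x∈𝔽 ⟩
    x ^ (2 ^ℕ b)                ∎

  fixed-+ : ∀ {a b x} → Fixed a x → Fixed b x → Fixed (a +ℕ b) x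
  fixed-+ {a} {b} x∈𝔽a x∈𝔽b = trans (fixed-shift {a} x∈𝔽a b) x∈𝔽b

  fixed-∸ : ∀ {a b x} → Fixed (a +ℕ b) x → Fixed b x → Fixed a x
  fixed-∸ {a} {b} {x} x∈𝔽a+b x∈𝔽b = begin
    x ^ (2 ^ℕ a)          ≡⟨ fixed-shift {b} x∈𝔽b a ⟨
    x ^ (2 ^ℕ (b +ℕ a))   ≡⟨ cong (λ e → x ^ (2 ^ℕ e)) (ℕ.+-comm b a) ⟩
    x ^ (2 ^ℕ (a +ℕ b))   ≡⟨ x∈𝔽a+b ⟩
    x                     ∎

  fixed-* : ∀ {a x} → Fixed a x → ∀ j → Fixed (j *ℕ a) x
  fixed-* x∈𝔽 zero    = *-identityʳ _
  fixed-* {a} x∈𝔽 (suc j) = fixed-+ {a} {j *ℕ a} x∈𝔽 (fixed-* {a} x∈𝔽 j)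

  fixed-of-order : ∀ {x n d} j → x ^ n ≡ 1# → 2 ^ℕ d ≡ suc (n *ℕ j) → Fixed d x
  fixed-of-order {x} {n} {d} j xⁿ≡1 2^d≡1+nj = begin
    x ^ (2 ^ℕ d)         ≡⟨ cong (x ^_) 2^d≡1+nj ⟩
    x * x ^ (n *ℕ j)     ≡⟨ cong (x *_) (^-*-assoc x n j) ⟨
    x * (x ^ n) ^ j      ≡⟨ cong (λ y → x * y ^ j) xⁿ≡1 ⟩
    x * 1# ^ j           ≡⟨ cong (x *_) (1^n≡1 j) ⟩
    x * 1#               ≡⟨ *-identityʳ x ⟩
    x                    ∎

module OddDegree (k : ℕ) (K : FiniteField (2 *ℕ k +ℕ 1)) where

  open FiniteField K
  open FiniteFieldProperties K public
  open ≡-Reasoning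

  m : ℕ
  m = 2 *ℕ k +ℕ 1

  char-2 : 1# + 1# ≡ 0#
  char-2 = begin
    1# + 1#    ≡⟨ cong (1# +_) 1≡-1 ⟩
    1# + - 1#  ≡⟨ -‿inverseʳ 1# ⟩
    0#         ∎
    where
    open import Algebra.Properties.Ring (CommutativeRing.ring commutativeRing) using (-1*x≈-x; -‿involutive)
    [-1]²≡1 : (- 1#) ^ 2 ≡ 1#
    [-1]²≡1 = trans (cong (- 1# *_) (*-identityʳ (- 1#))) (trans (-1*x≈-x (- 1#)) (-‿involutive 1#))
    1≡-1 : 1# ≡ - 1#
    1≡-1 = begin
      1#                                  ≡⟨ 1^n≡1 (2 ^ℕ (2 *ℕ k)) ⟨
      1# ^ (2 ^ℕ (2 *ℕ k))                ≡⟨ cong (_^ (2 ^ℕ (2 *ℕ k))) [-1]²≡1 ⟨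
      ((- 1#) ^ 2) ^ (2 ^ℕ (2 *ℕ k))      ≡⟨ ^-*-assoc (- 1#) 2 (2 ^ℕ (2 *ℕ k)) ⟩
      (- 1#) ^ (2 *ℕ 2 ^ℕ (2 *ℕ k))       ≡⟨ cong ((- 1#) ^_) (ℕ.*-comm 2 (2 ^ℕ (2 *ℕ k))) ⟩
      (- 1#) ^ (2 ^ℕ (2 *ℕ k) *ℕ 2)       ≡⟨ cong ((- 1#) ^_) (ℕ.^-distribˡ-+-* 2 (2 *ℕ k) 1) ⟨
      (- 1#) ^ (2 ^ℕ m)                   ≡⟨ fermat (- 1#) ⟩
      - 1#                                ∎

  open Char2RingSolver isCommutativeRing char-2 public

  frobenius-+ : ∀ j x y → (x + y) ^ (2 ^ℕ j) ≡ x ^ (2 ^ℕ j) + y ^ (2 ^ℕ j)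
  frobenius-+ zero    = solve 2 (λ x y → (x :+ y) :^ 1 := x :^ 1 :+ y :^ 1) refl
  frobenius-+ (suc j) x y = begin
    (x + y) ^ (2 *ℕ 2 ^ℕ j)                  ≡⟨ ^-*-assoc (x + y) 2 (2 ^ℕ j) ⟨
    ((x + y) ^ 2) ^ (2 ^ℕ j)                 ≡⟨ cong (_^ (2 ^ℕ j)) (solve 2 (λ x y → (x :+ y) :^ 2 := x :^ 2 :+ y :^ 2) refl x y) ⟩
    (x ^ 2 + y ^ 2) ^ (2 ^ℕ j)               ≡⟨ frobenius-+ j (x ^ 2) (y ^ 2) ⟩
    (x ^ 2) ^ (2 ^ℕ j) + (y ^ 2) ^ (2 ^ℕ j)  ≡⟨ cong₂ _+_ (^-*-assoc x 2 (2 ^ℕ j)) (^-*-assoc y 2 (2 ^ℕ j)) ⟩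
    x ^ (2 *ℕ 2 ^ℕ j) + y ^ (2 *ℕ 2 ^ℕ j)    ∎

  fixed-half : ∀ {e x} → Fixed (2 *ℕ e) x → Fixed e x
  fixed-half {e} {x} x∈𝔽2e = fixed-∸ {e} {e *ℕ m}
    (subst (λ d → Fixed d x) (arith k e) (fixed-* {2 *ℕ e} x∈𝔽2e (suc k)))
    (fixed-* {m} (fermat x) e)
    where
    arith : ∀ k e → suc k *ℕ (2 *ℕ e) ≡ e +ℕ e *ℕ (2 *ℕ k +ℕ 1)
    arith = solve-∀

  -- 𝔽_{2^12} ∩ 𝔽_{2^m} ⊆ 𝔽₈, as m is odd
  order∣4095⇒∈𝔽₈ : ∀ {x} n j → x ^ n ≡ 1# → n *ℕ j ≡ 4095 → Fixed 3 x
  order∣4095⇒∈𝔽₈ n j xⁿ≡1 nj≡4095 =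
    fixed-half {3} (fixed-half {6} (fixed-of-order {n = n} {d = 12} j xⁿ≡1 (cong suc (sym nj≡4095))))

  -- The roots of p have order dividing n ∣ 4095, so they lie in 𝔽₈; the Bézout identity
  -- 1 = a p + b (x ^ 8 + x) says that p has no roots there.
  no-root : ∀ {p q a b : F → F} n j → n *ℕ j ≡ 4095 →
            (∀ x → x ^ n + 1# ≡ q x * p x) → (∀ x → 1# ≡ a x * p x + b x * (x ^ 8 + x)) →
            ∀ x → p x ≢ 0#
  no-root n j nj≡4095 order bézout x p≡0 =
    1≢0 (trans (bézout x) (vanishes _ p≡0 ⊕₀ vanishes _ (≡⇒+≡0 x∈𝔽₈)))
    where
    x∈𝔽₈ : Fixed 3 x
    x∈𝔽₈ = order∣4095⇒∈𝔽₈ n j (+≡0⇒≡ (trans (order x) (vanishes _ p≡0))) nj≡4095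

  x²+x+1≢0 : ∀ x → x ^ 2 + x + 1# ≢ 0#
  x²+x+1≢0 = no-root 3 1365 refl
    (solve 1 (λ x → x :^ 3 :+ :1 := (x :+ :1) :* (x :^ 2 :+ x :+ :1)) refl)
    (solve 1 (λ x → :1
                  := (x :^ 6 :+ x :^ 5 :+ x :^ 3 :+ x :^ 2 :+ :1) :* (x :^ 2 :+ x :+ :1) :+ :1 :* (x :^ 8 :+ x)) refl)

  x⁴+x+1≢0 : ∀ x → x ^ 4 + x + 1# ≢ 0#
  x⁴+x+1≢0 = no-root 15 273 refl
    (solve 1 (λ x → x :^ 15 :+ :1
                  := (x :^ 11 :+ x :^ 8 :+ x :^ 7 :+ x :^ 5 :+ x :^ 3 :+ x :^ 2 :+ x :+ :1) :* (x :^ 4 :+ x :+ :1)) refl)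
    (solve 1 (λ x → :1
                  := (x :^ 6 :+ x :^ 5 :+ x :^ 3 :+ x :+ :1) :* (x :^ 4 :+ x :+ :1) :+ (x :^ 2 :+ x) :* (x :^ 8 :+ x)) refl)

  x⁴+x³+1≢0 : ∀ x → x ^ 4 + x ^ 3 + 1# ≢ 0#
  x⁴+x³+1≢0 = no-root 15 273 refl
    (solve 1 (λ x → x :^ 15 :+ :1
                  := (x :^ 11 :+ x :^ 10 :+ x :^ 9 :+ x :^ 8 :+ x :^ 6 :+ x :^ 4 :+ x :^ 3 :+ :1) :* (x :^ 4 :+ x :^ 3 :+ :1)) refl)
    (solve 1 (λ x → :1
                  := (x :^ 5 :+ x :^ 4 :+ x :^ 3 :+ x :^ 2 :+ :1) :* (x :^ 4 :+ x :^ 3 :+ :1) :+ x :* (x :^ 8 :+ x)) refl)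

  x⁶+x³+1≢0 : ∀ x → x ^ 6 + x ^ 3 + 1# ≢ 0#
  x⁶+x³+1≢0 = no-root 9 455 refl
    (solve 1 (λ x → x :^ 9 :+ :1 := (x :^ 3 :+ :1) :* (x :^ 6 :+ x :^ 3 :+ :1)) refl)
    (solve 1 (λ x → :1
                  := (x :^ 6 :+ x :^ 4 :+ x :^ 2 :+ x :+ :1) :* (x :^ 6 :+ x :^ 3 :+ :1) :+ (x :^ 4 :+ x :^ 2 :+ x :+ :1) :* (x :^ 8 :+ x)) refl)

  x⁶+x⁴+x²+x+1≢0 : ∀ x → x ^ 6 + x ^ 4 + x ^ 2 + x + 1# ≢ 0#
  x⁶+x⁴+x²+x+1≢0 = no-root 21 195 refl
    (solve 1 (λ x → x :^ 21 :+ :1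
                  := (x :^ 15 :+ x :^ 13 :+ x :^ 10 :+ x :^ 7 :+ x :^ 6 :+ x :^ 3 :+ x :+ :1) :* (x :^ 6 :+ x :^ 4 :+ x :^ 2 :+ x :+ :1)) refl)
    (solve 1 (λ x → :1
                  := (x :^ 6 :+ x :^ 3 :+ :1) :* (x :^ 6 :+ x :^ 4 :+ x :^ 2 :+ x :+ :1) :+ (x :^ 4 :+ x :^ 2 :+ x :+ :1) :* (x :^ 8 :+ x)) refl)

  halfTrace : ℕ → F → F
  halfTrace zero    w = w
  halfTrace (suc i) w = halfTrace i w + w ^ (2 ^ℕ (2 *ℕ suc i))

  halfTrace-²+ : ∀ i w → halfTrace i w ^ 2 + halfTrace i w ≡ trace-sum (2 +ℕ 2 *ℕ i) w
  halfTrace-²+ zero    w = solve 1 (λ w → w :^ 2 :+ w := :0 :+ w :^ 1 :+ w :^ 2) refl w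
  halfTrace-²+ (suc i) w = begin
    (h + t) ^ 2 + (h + t)
      ≡⟨ solve 2 (λ h t → (h :+ t) :^ 2 :+ (h :+ t) := (h :^ 2 :+ h) :+ t :+ t :^ 2) refl h t ⟩
    (h ^ 2 + h) + t + t ^ 2
      ≡⟨ cong₂ (λ a b → a + t + b) (halfTrace-²+ i w) t²≡w^2^[n+1] ⟩
    trace-sum (2 +ℕ 2 *ℕ i) w + t + w ^ (2 ^ℕ suc n)
      ≡⟨ cong (λ j → trace-sum j w + t + w ^ (2 ^ℕ suc n)) (ℕ.*-suc 2 i) ⟨
    trace-sum (2 +ℕ n) w
      ∎
    where
    n = 2 *ℕ suc i
    h = halfTrace i w
    t = w ^ (2 ^ℕ n)
    t²≡w^2^[n+1] : t ^ 2 ≡ w ^ (2 ^ℕ suc n)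
    t²≡w^2^[n+1] = trans (^-*-assoc w (2 ^ℕ n) 2) (cong (w ^_) (ℕ.*-comm (2 ^ℕ n) 2))

  halfTrace-solves : ∀ {w} → Tr w ≡ 0# → halfTrace k w ^ 2 + halfTrace k w ≡ w
  halfTrace-solves {w} Tr[w]≡0 = begin
    halfTrace k w ^ 2 + halfTrace k w   ≡⟨ halfTrace-²+ k w ⟩
    trace-sum (1 +ℕ 2 *ℕ k) w + w ^ (2 ^ℕ (1 +ℕ 2 *ℕ k))
                                        ≡⟨ cong (λ j → trace-sum j w + w ^ (2 ^ℕ j)) (ℕ.+-comm 1 (2 *ℕ k)) ⟩
    Tr w + w ^ (2 ^ℕ m)                 ≡⟨ cong₂ _+_ Tr[w]≡0 (fermat w) ⟩
    0# + w                              ≡⟨ +-identityˡ w ⟩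
    w                                   ∎

  τ : ℕ
  τ = 2 ^ℕ (k +ℕ 1)

  σ : F → F
  σ x = x ^ τ

  σ-+ : ∀ x y → σ (x + y) ≡ σ x + σ y
  σ-+ = frobenius-+ (k +ℕ 1)

  σ-* : ∀ x y → σ (x * y) ≡ σ x * σ y
  σ-* x y = ^-distribʳ-* x y τ

  σ-0 : σ 0# ≡ 0#
  σ-0 = 0^n≡0 (ℕ.m^n>0 2 (k +ℕ 1))

  σ-1 : σ 1# ≡ 1#
  σ-1 = 1^n≡1 τ

  σ∘σ : ∀ x → σ (σ x) ≡ x ^ 2
  σ∘σ x = begin
    (x ^ τ) ^ τ                    ≡⟨ ^-*-assoc x τ τ ⟩
    x ^ (τ *ℕ τ)                   ≡⟨ cong (x ^_) (ℕ.^-distribˡ-+-* 2 (k +ℕ 1) (k +ℕ 1)) ⟨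
    x ^ (2 ^ℕ ((k +ℕ 1) +ℕ (k +ℕ 1)))  ≡⟨ cong (λ e → x ^ (2 ^ℕ e)) (arith k) ⟩
    x ^ (2 ^ℕ (m +ℕ 1))            ≡⟨ fixed-shift {m} (fermat x) 1 ⟩
    x ^ 2                          ∎
    where
    arith : ∀ k → (k +ℕ 1) +ℕ (k +ℕ 1) ≡ (2 *ℕ k +ℕ 1) +ℕ 1
    arith = solve-∀

  σ-⟦⟧ : ∀ {n} (p : Polynomial n) (ρ : Env n) → σ (⟦ p ⟧ ρ) ≡ ⟦ p ⟧ (Vec.map σ ρ)
  σ-⟦⟧ = homomorphism-⟦⟧ σ σ-+ σ-* σ-0 σ-1

  σ-≡ : ∀ {n} (p q : Polynomial n) (ρ : Env n) →
        ⟦ p ⟧ ρ ≡ ⟦ q ⟧ ρ → ⟦ p ⟧ (Vec.map σ ρ) ≡ ⟦ q ⟧ (Vec.map σ ρ)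
  σ-≡ = homomorphism-≡ σ σ-+ σ-* σ-0 σ-1

module TwoRoots (k : ℕ) (K : FiniteField (2 *ℕ k +ℕ 1)) where

  open FiniteField K
  open OddDegree k K
  open ≡-Reasoning

  Nₚ : ∀ {n} → Polynomial n → Polynomial n → Polynomial n
  Nₚ c u = c :^ 4 :+ c :^ 3 :* u :^ 2 :+ c :^ 3 :* u :+ c :^ 2 :* u :^ 3 :+ c :^ 2 :* u :^ 2
           :+ c :^ 2 :* u :+ c :* u :^ 2 :+ c :* u :+ u :+ :1

  N : F → F → F
  N c u = ⟦ Nₚ x₀ x₁ ⟧ (c ∷ u ∷ [])

  G : F → F
  G c = c ^ 4 * (c + 1#) ^ 2 * (c ^ 4 + c + 1#) * (c ^ 4 + c ^ 3 + 1#)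
          * (c ^ 6 + c ^ 3 + 1#) * (c ^ 6 + c ^ 4 + c ^ 2 + c + 1#)

  G≢0 : ∀ {c} → c ≢ 0# → c ≢ 1# → G c ≢ 0#
  G≢0 {c} c≢0 c≢1 = *-nonzero (*-nonzero (*-nonzero (*-nonzero (*-nonzero
    (^-nonzero 4 c≢0) (^-nonzero 2 (c≢1 ∘ +≡0⇒≡)))
    (x⁴+x+1≢0 c)) (x⁴+x³+1≢0 c)) (x⁶+x³+1≢0 c)) (x⁶+x⁴+x²+x+1≢0 c)

  -- The cofactors come from the resultant of N c u and N u (c ^ 2) with respect to u.
  N-resultant : ∀ c u → N c u ≡ 0# → N u (c ^ 2) ≡ 0# → G c ≡ 0#
  N-resultant c u Ncu≡0 Nuc²≡0 = trans
    (solve 2 (λ c u →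
      c :^ 4 :* (c :+ :1) :^ 2 :* (c :^ 4 :+ c :+ :1) :* (c :^ 4 :+ c :^ 3 :+ :1)
        :* (c :^ 6 :+ c :^ 3 :+ :1) :* (c :^ 6 :+ c :^ 4 :+ c :^ 2 :+ c :+ :1)
      := ((c :^ 15 :+ c :^ 14 :+ c :^ 13 :+ c :^ 10 :+ c :^ 8 :+ c :^ 5 :+ c :^ 4 :+ c :^ 3 :+ c :^ 2 :+ c :+ :1) :* u :^ 3
          :+ (c :^ 19 :+ c :^ 18 :+ c :^ 8 :+ c :^ 7 :+ c :^ 6 :+ c :^ 5 :+ c :^ 4 :+ c :^ 2 :+ c :+ :1) :* u :^ 2
          :+ (c :^ 21 :+ c :^ 19 :+ c :^ 18 :+ c :^ 17 :+ c :^ 16 :+ c :^ 15 :+ c :^ 14 :+ c :^ 12 :+ c :^ 9 :+ c :^ 4 :+ c :^ 3 :+ c :^ 2 :+ c :+ :1) :* u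
          :+ (c :^ 22 :+ c :^ 21 :+ c :^ 18 :+ c :^ 14 :+ c :^ 11 :+ c :^ 10 :+ c :^ 9 :+ c :^ 8 :+ c :^ 7 :+ c :^ 6 :+ c :^ 5 :+ c :^ 4 :+ c :^ 2 :+ c :+ :1))
         :* Nₚ c u
       :+ ((c :^ 17 :+ c :^ 16 :+ c :^ 15 :+ c :^ 12 :+ c :^ 10 :+ c :^ 7 :+ c :^ 6 :+ c :^ 5 :+ c :^ 4 :+ c :^ 3 :+ c :^ 2) :* u :^ 2
          :+ (c :^ 17 :+ c :^ 14 :+ c :^ 13 :+ c :^ 11 :+ c :^ 10 :+ c :^ 7 :+ c :^ 4 :+ c :^ 2 :+ c) :* u
          :+ (c :^ 19 :+ c :^ 18 :+ c :^ 17 :+ c :^ 16 :+ c :^ 15 :+ c :^ 11 :+ c :^ 8 :+ c :^ 7 :+ c :^ 5 :+ c :^ 4 :+ c :^ 3 :+ c :+ :1))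
         :* Nₚ u (c :^ 2))
      refl c u)
    (vanishes _ Ncu≡0 ⊕₀ vanishes _ Nuc²≡0)

  module Roots (c : F) (c≢0 : c ≢ 0#) (Tr≡0 : Tr (c ^ (τ +ℕ 2) + c + 1#) ≡ 0#) where

    c⁻¹ u u⁻¹ : F
    c⁻¹ = inv c
    u   = σ c
    u⁻¹ = σ c⁻¹

    c*c⁻¹≡1 : c * c⁻¹ ≡ 1#
    c*c⁻¹≡1 = inv-r c c≢0

    u*u⁻¹≡1 : u * u⁻¹ ≡ 1#
    u*u⁻¹≡1 = trans (sym (σ-* c c⁻¹)) (trans (cong σ c*c⁻¹≡1) σ-1)

    u⁻¹≢0 : u⁻¹ ≢ 0#
    u⁻¹≢0 = unit-nonzero (trans (*-comm u⁻¹ u) u*u⁻¹≡1)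

    y : F
    y = halfTrace k (c ^ (τ +ℕ 2) + c + 1#)

    y²+y≡uc²+c+1 : y ^ 2 + y ≡ u * c ^ 2 + c + 1#
    y²+y≡uc²+c+1 = trans (halfTrace-solves Tr≡0) (cong (λ t → t + c + 1#) (^-distribˡ-+-* c τ 2))

    c≢1 : c ≢ 1#
    c≢1 c≡1 = x²+x+1≢0 y (begin
      y ^ 2 + y + 1#                          ≡⟨ cong (_+ 1#) y²+y≡uc²+c+1 ⟩
      σ c * c ^ 2 + c + 1# + 1#               ≡⟨ cong (λ t → σ t * t ^ 2 + t + 1# + 1#) c≡1 ⟩
      σ 1# * 1# ^ 2 + 1# + 1# + 1#            ≡⟨ cong (λ t → t * 1# ^ 2 + 1# + 1# + 1#) σ-1 ⟩
      1# * 1# ^ 2 + 1# + 1# + 1#              ≡⟨ solve 0 (:1 :* :1 :^ 2 :+ :1 :+ :1 :+ :1 := :0) refl ⟩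
      0#                                      ∎)

    u+1≢0 : u + 1# ≢ 0#
    u+1≢0 u+1≡0 = ^-nonzero τ (λ c+1≡0 → c≢1 (+≡0⇒≡ c+1≡0)) (begin
      σ (c + 1#)   ≡⟨ σ-+ c 1# ⟩
      u + σ 1#     ≡⟨ cong (u +_) σ-1 ⟩
      u + 1#       ≡⟨ u+1≡0 ⟩
      0#           ∎)

    v : F
    v = (1# / (c ^ τ + 1#)) * (c ^ 2 + c / (c ^ τ) + c ^ (τ +ℕ 1))

    B : F
    B = (1# + u) * (1# + c) ^ 2 + u * v + c ^ 2 * σ v + c

    f₁ : F → F
    f₁ X = X ^ τ / c ^ τ + X / c ^ 2 + (1# / c + 1#) ^ (τ +ℕ 2)
           + v / c ^ 2 + v ^ τ / c ^ τ + 1# / c ^ (τ +ℕ 1)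

    f₁≡ : ∀ X → f₁ X ≡ u⁻¹ * c⁻¹ ^ 2 * (c ^ 2 * σ X + u * X + B)
    f₁≡ X = begin
      f₁ X
        ≡⟨⟩
      σ X * inv u + X * inv (c ^ 2) + e ^ (τ +ℕ 2) + v * inv (c ^ 2) + σ v * inv u + 1# * inv (c ^ (τ +ℕ 1))
        ≡⟨ cong (λ t → σ X * t + X * inv (c ^ 2) + e ^ (τ +ℕ 2) + v * inv (c ^ 2) + σ v * t + 1# * inv (c ^ (τ +ℕ 1)))
                (inv-^ τ c≢0) ⟩
      σ X * u⁻¹ + X * inv (c ^ 2) + e ^ (τ +ℕ 2) + v * inv (c ^ 2) + σ v * u⁻¹ + 1# * inv (c ^ (τ +ℕ 1))
        ≡⟨ cong (λ t → σ X * u⁻¹ + X * t + e ^ (τ +ℕ 2) + v * t + σ v * u⁻¹ + 1# * inv (c ^ (τ +ℕ 1)))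
                (inv-^ 2 c≢0) ⟩
      σ X * u⁻¹ + X * c⁻¹ ^ 2 + e ^ (τ +ℕ 2) + v * c⁻¹ ^ 2 + σ v * u⁻¹ + 1# * inv (c ^ (τ +ℕ 1))
        ≡⟨ cong (λ t → σ X * u⁻¹ + X * c⁻¹ ^ 2 + e ^ (τ +ℕ 2) + v * c⁻¹ ^ 2 + σ v * u⁻¹ + 1# * t)
                (trans (inv-^ (τ +ℕ 1) c≢0) (^-distribˡ-+-* c⁻¹ τ 1)) ⟩
      σ X * u⁻¹ + X * c⁻¹ ^ 2 + e ^ (τ +ℕ 2) + v * c⁻¹ ^ 2 + σ v * u⁻¹ + 1# * (u⁻¹ * c⁻¹ ^ 1)
        ≡⟨ cong (λ t → σ X * u⁻¹ + X * c⁻¹ ^ 2 + t + v * c⁻¹ ^ 2 + σ v * u⁻¹ + 1# * (u⁻¹ * c⁻¹ ^ 1))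
                (trans (^-distribˡ-+-* e τ 2) (cong (_* e ^ 2) σe)) ⟩
      σ X * u⁻¹ + X * c⁻¹ ^ 2 + (1# * u⁻¹ + 1#) * e ^ 2 + v * c⁻¹ ^ 2 + σ v * u⁻¹ + 1# * (u⁻¹ * c⁻¹ ^ 1)
        ≡⟨ certified
             (solve 8 (λ c c⁻¹ u u⁻¹ X S v w →
                S :* u⁻¹ :+ X :* c⁻¹ :^ 2 :+ (:1 :* u⁻¹ :+ :1) :* (:1 :* c⁻¹ :+ :1) :^ 2 :+ v :* c⁻¹ :^ 2
                  :+ w :* u⁻¹ :+ :1 :* (u⁻¹ :* c⁻¹ :^ 1)
                := u⁻¹ :* c⁻¹ :^ 2 :* (c :^ 2 :* S :+ u :* X :+ ((:1 :+ u) :* (:1 :+ c) :^ 2 :+ u :* v :+ c :^ 2 :* w :+ c))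
                   :+ (u⁻¹ :* ((c⁻¹ :* c :+ :1) :* (u :+ S :+ w :+ :1) :+ c⁻¹) :* (c :* c⁻¹ :+ :1)
                       :+ (c⁻¹ :^ 2 :* (X :+ v :+ :1) :+ :1) :* (u :* u⁻¹ :+ :1)))
                refl c c⁻¹ u u⁻¹ X (σ X) v (σ v))
             (vanishes _ (≡⇒+≡0 c*c⁻¹≡1) ⊕₀ vanishes _ (≡⇒+≡0 u*u⁻¹≡1)) ⟩
      u⁻¹ * c⁻¹ ^ 2 * (c ^ 2 * σ X + u * X + B)
        ∎
      where
      e : F
      e = 1# * c⁻¹ + 1#
      σe : σ e ≡ 1# * u⁻¹ + 1#
      σe = trans (σ-+ (1# * c⁻¹) 1#) (cong₂ _+_ (trans (σ-* 1# c⁻¹) (cong (_* u⁻¹) σ-1)) σ-1)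

    f₁-root : ∀ {Z} → σ Z + Z ≡ B → f₁ (u⁻¹ * Z) ≡ 0#
    f₁-root {Z} σZ+Z≡B = begin
      f₁ (u⁻¹ * Z)
        ≡⟨ f₁≡ (u⁻¹ * Z) ⟩
      u⁻¹ * c⁻¹ ^ 2 * (c ^ 2 * σ (u⁻¹ * Z) + u * (u⁻¹ * Z) + B)
        ≡⟨ cong (λ t → u⁻¹ * c⁻¹ ^ 2 * (c ^ 2 * t + u * (u⁻¹ * Z) + B))
                (trans (σ-* u⁻¹ Z) (cong (_* σ Z) (σ∘σ c⁻¹))) ⟩
      u⁻¹ * c⁻¹ ^ 2 * (c ^ 2 * (c⁻¹ ^ 2 * σ Z) + u * (u⁻¹ * Z) + B)
        ≡⟨ trans
             (solve 7 (λ c c⁻¹ u u⁻¹ S Z B →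
                u⁻¹ :* c⁻¹ :^ 2 :* (c :^ 2 :* (c⁻¹ :^ 2 :* S) :+ u :* (u⁻¹ :* Z) :+ B)
                := u⁻¹ :* c⁻¹ :^ 2 :* S :* (c⁻¹ :* c :+ :1) :* (c :* c⁻¹ :+ :1)
                   :+ u⁻¹ :* c⁻¹ :^ 2 :* Z :* (u :* u⁻¹ :+ :1)
                   :+ u⁻¹ :* c⁻¹ :^ 2 :* (S :+ Z :+ B))
                refl c c⁻¹ u u⁻¹ (σ Z) Z B)
             (vanishes _ (≡⇒+≡0 c*c⁻¹≡1) ⊕₀ vanishes _ (≡⇒+≡0 u*u⁻¹≡1) ⊕₀ vanishes _ (≡⇒+≡0 σZ+Z≡B)) ⟩
      0#
        ∎

    W : F
    W = σ y + y + u * v + u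

    σW+W≡B : σ W + W ≡ B
    σW+W≡B = certified
      (trans (cong (_+ W) σW)
        (solve 6 (λ y y′ c u v w →
          (y :^ 2 :+ y′ :+ c :^ 2 :* w :+ c :^ 2) :+ (y′ :+ y :+ u :* v :+ u)
          := ((:1 :+ u) :* (:1 :+ c) :^ 2 :+ u :* v :+ c :^ 2 :* w :+ c) :+ :1 :* (y :^ 2 :+ y :+ (u :* c :^ 2 :+ c :+ :1)))
          refl y (σ y) c u v (σ v)))
      (vanishes 1# (≡⇒+≡0 y²+y≡uc²+c+1))
      where
      σW : σ W ≡ y ^ 2 + σ y + c ^ 2 * σ v + c ^ 2
      σW = trans (σ-⟦⟧ (x₀ :+ x₁ :+ x₂ :* x₃ :+ x₂) (σ y ∷ y ∷ u ∷ v ∷ []))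
                 (cong₂ (λ a b → a + σ y + b * σ v + b) (σ∘σ y) (σ∘σ c))

    σW′+W′≡B : σ (W + 1#) + (W + 1#) ≡ B
    σW′+W′≡B = begin
      σ (W + 1#) + (W + 1#)  ≡⟨ cong (_+ (W + 1#)) (trans (σ-+ W 1#) (cong (σ W +_) σ-1)) ⟩
      (σ W + 1#) + (W + 1#)  ≡⟨ solve 2 (λ a b → (a :+ :1) :+ (b :+ :1) := a :+ b) refl (σ W) W ⟩
      σ W + W                ≡⟨ σW+W≡B ⟩
      B                      ∎

    v-equation : (u + 1#) * (u * v) ≡ u * c ^ 2 + c + u ^ 2 * c
    v-equation = certified
      (trans (cong (λ t → (u + 1#) * (u * t)) v≡)
        (solve 5 (λ c u u⁻¹ a v →
          (u :+ :1) :* (u :* ((:1 :* a) :* (c :^ 2 :+ c :* u⁻¹ :+ u :* c :^ 1)))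
          := (u :* c :^ 2 :+ c :+ u :^ 2 :* c)
             :+ ((u :* c :^ 2 :+ u :* u⁻¹ :* c :+ u :^ 2 :* c) :* ((u :+ :1) :* a :+ :1) :+ c :* (u :* u⁻¹ :+ :1)))
          refl c u u⁻¹ (inv (u + 1#)) v))
      (vanishes _ (≡⇒+≡0 (inv-r (u + 1#) u+1≢0)) ⊕₀ vanishes c (≡⇒+≡0 u*u⁻¹≡1))
      where
      v≡ : v ≡ (1# * inv (u + 1#)) * (c ^ 2 + c * u⁻¹ + u * c ^ 1)
      v≡ = cong₂ (λ a b → (1# * inv (u + 1#)) * (c ^ 2 + c * a + b)) (inv-^ τ c≢0) (^-distribˡ-+-* c τ 1)

    σv-equation : (c ^ 2 + 1#) * (c ^ 2 * σ v) ≡ c ^ 2 * u ^ 2 + u + (c ^ 2) ^ 2 * u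
    σv-equation = subst (λ t → (t + 1#) * (t * σ v) ≡ t * u ^ 2 + u + t ^ 2 * u) (σ∘σ c)
      (σ-≡ ((x₁ :+ :1) :* (x₁ :* x₂)) (x₁ :* x₀ :^ 2 :+ x₀ :+ x₁ :^ 2 :* x₀) (c ∷ u ∷ v ∷ []) v-equation)

    B-cleared : (u + 1#) * (c ^ 2 + 1#) * B ≡ N c u
    B-cleared = certified
      (solve 4 (λ c u v w →
        (u :+ :1) :* (c :^ 2 :+ :1) :* ((:1 :+ u) :* (:1 :+ c) :^ 2 :+ u :* v :+ c :^ 2 :* w :+ c)
        := Nₚ c u :+ ((c :^ 2 :+ :1) :* ((u :+ :1) :* (u :* v) :+ (u :* c :^ 2 :+ c :+ u :^ 2 :* c))
                      :+ (u :+ :1) :* ((c :^ 2 :+ :1) :* (c :^ 2 :* w) :+ (c :^ 2 :* u :^ 2 :+ u :+ (c :^ 2) :^ 2 :* u))))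
        refl c u v (σ v))
      (vanishes _ (≡⇒+≡0 v-equation) ⊕₀ vanishes _ (≡⇒+≡0 σv-equation))

    B≢0 : B ≢ 0#
    B≢0 B≡0 = G≢0 c≢0 c≢1 (N-resultant c u Ncu≡0 Nuc²≡0)
      where
      Ncu≡0 : N c u ≡ 0#
      Ncu≡0 = trans (sym B-cleared) (trans (cong ((u + 1#) * (c ^ 2 + 1#) *_) B≡0) (zeroʳ _))
      Nuc²≡0 : N u (c ^ 2) ≡ 0#
      Nuc²≡0 = begin
        N u (c ^ 2)    ≡⟨ cong (N u) (σ∘σ c) ⟨
        N u (σ u)      ≡⟨ σ-⟦⟧ (Nₚ x₀ x₁) (c ∷ u ∷ []) ⟨
        σ (N c u)      ≡⟨ cong σ Ncu≡0 ⟩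
        σ 0#           ≡⟨ σ-0 ⟩
        0#             ∎

    root-nonzero : ∀ {Z} → σ Z + Z ≡ B → u⁻¹ * Z ≢ 0#
    root-nonzero {Z} σZ+Z≡B u⁻¹Z≡0 = B≢0 (begin
      B           ≡⟨ σZ+Z≡B ⟨
      σ Z + Z     ≡⟨ cong (λ t → σ t + t) Z≡0 ⟩
      σ 0# + 0#   ≡⟨ cong (_+ 0#) σ-0 ⟩
      0# + 0#     ≡⟨ +-identityʳ 0# ⟩
      0#          ∎)
      where
      Z≡0 : Z ≡ 0#
      Z≡0 = *-cancelˡ u⁻¹ u⁻¹≢0 (trans u⁻¹Z≡0 (sym (zeroʳ u⁻¹)))

    roots-distinct : u⁻¹ * W ≢ u⁻¹ * (W + 1#)
    roots-distinct u⁻¹W≡u⁻¹[W+1] = 1≢0 (trans (solve 1 (λ w → :1 := w :+ (w :+ :1)) refl W)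
                                               (≡⇒+≡0 (*-cancelˡ u⁻¹ u⁻¹≢0 u⁻¹W≡u⁻¹[W+1])))

lemma4p4 : (k : ℕ) → 1 ≤ k → (K : FiniteField (2 *ℕ k +ℕ 1)) →
    let open FiniteField K
        τ : ℕ
        τ = 2 ^ℕ (k +ℕ 1)
    in (c : F) → c ≢ 0# →
    Tr (c ^ (τ +ℕ 2) + c + 1#) ≡ 0# →
    let v : F
        v = (1# / (c ^ τ + 1#)) * (c ^ 2 + c / (c ^ τ) + c ^ (τ +ℕ 1))
        f₁ : F → F
        f₁ X = X ^ τ / c ^ τ + X / c ^ 2 + (1# / c + 1#) ^ (τ +ℕ 2)
               + v / c ^ 2 + v ^ τ / c ^ τ + 1# / c ^ (τ +ℕ 1)
    in Σ F λ x₁ → Σ F λ x₂ →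
         x₁ ≢ x₂ × x₁ ≢ 0# × x₂ ≢ 0# × f₁ x₁ ≡ 0# × f₁ x₂ ≡ 0#
lemma4p4 k _ K c c≢0 Tr≡0 =
  u⁻¹ * W , u⁻¹ * (W + 1#) ,
  roots-distinct , root-nonzero σW+W≡B , root-nonzero σW′+W′≡B , f₁-root σW+W≡B , f₁-root σW′+W′≡B
  where
  open FiniteField K using (_*_; _+_; 1#)
  open TwoRoots.Roots k K c c≢0 Tr≡0
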